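{- Let $n>0$ and let $W$ be the ADI word of a DI-sortable permutation of $[n]$. Then the word $S=\Phi(W)$ is a Schröder path from $(0,0)$ to $(n-1,n-1)$.
   Context: A permutation $\pi=\pi_1\cdots\pi_n$ of $[n]$ is processed by a machine consisting of an input (initially $\pi_1,\dots,\pi_n$), a first stack, a second stack, and an output, with operations: $\mathsf{E}$ moves the next input entry onto the top of the first stack; $\mathsf{N}$ pops the top of the first stack and pushes it onto the second stack; $\mathsf{C}$ pops the top of the second stack to the output. A DI word of $\pi$ is a word over $\{\mathsf{E},\mathsf{N},\mathsf{C}\}$ whose operations are all legal when applied in order starting from $\pi$ in the input and empty stacks, whose final output is $12\cdots n$, and during which the first stack's entries always decrease from top to bottom and the second stack's entries always increase from top to bottom; $\pi$ is DI-sortable if it has a DI word. The ADI word of a DI-sortable $\pi$ is the word of operations performed by the following algorithm, which at each stage performs the first applicable step: (1) if the top entry of the second stack is the smallest value not yet output, perform $\mathsf{C}$; (2) if the first stack is nonempty and its $m$ entries are exactly the next $m$ values to be output, transfer all of them to the second stack by $m$ successive $\mathsf{N}$ operations; (3) otherwise, if the next input entry is smaller than the top of the second stack and larger than the top of the first stack (each comparison counting as satisfied if the corresponding stack is empty), perform $\mathsf{E}$; (4) otherwise perform $\mathsf{N}$. In an ADI word, every maximal block of consecutive $\mathsf{C}$'s is immediately preceded by $\mathsf{E}\mathsf{N}$. The map $\Phi$: given an ADI word $W$ with $k$ maximal blocks of consecutive $\mathsf{C}$'s of lengths $\tau_1,\dots,\tau_k$ (in order), set $\ell_i=\tau_1+\cdots+\tau_i$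 (so $\ell_k=n$). Form $T$ by replacing each substring $\mathsf{E}\mathsf{N}\mathsf{C}^{\tau_i}$ (a maximal block of $\mathsf{C}$'s together with the two letters preceding it) by a single $\mathsf{N}$. Form $S_{\mathsf{D}}$ from $T$ by replacing, for each $i\in[k]$, the $\ell_i$-th $\mathsf{N}$ of $T$ by $\mathsf{D}$; the last letter of $S_{\mathsf{D}}$ is then $\mathsf{D}$; delete it to obtain $S=\Phi(W)$. A Schröder path from $(0,0)$ to $(m,m)$ is a word over $\{\mathsf{E},\mathsf{N},\mathsf{D}\}$ read as a lattice path with steps $\mathsf{E}=(1,0)$, $\mathsf{N}=(0,1)$, $\mathsf{D}=(1,1)$, starting at $(0,0)$, ending at $(m,m)$, and staying weakly below the line $y=x$ (for $m=0$, the empty path). -}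

module Defs where

open import Data.Nat using (ℕ; zero; suc; _+_; _≤_; _<_; _<ᵇ_; _≡ᵇ_)
open import Data.Bool using (Bool; true; false; _∧_; _∨_; not; if_then_else_)
open import Data.List using (List; []; _∷_; _++_; [_]; length; take; applyUpTo; replicate)
open import Data.Bool.ListAction using (any; all)
open import Data.List.Relation.Unary.Linked using (Linked)
open import Data.Maybe using (Maybe; just; nothing)
open import Data.Product using (_×_; _,_; proj₁; proj₂)
open import Relation.Binary.PropositionalEquality using (_≡_)

data Op : Set where
  E N C : Op

-- Stacks are lists whose head is the top.  The output is kept in the
-- order in which entries were output (first output entry first).
record State : Set where
  constructor mkState
  field
    input  : List ℕ
    stack1 : List ℕ
    stack2 : List ℕ
    output : List ℕ
open State public

initState : List ℕ → State
initState π = mkState π [] [] []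

exec : Op → State → Maybe State
exec E (mkState (x ∷ xs) s1 s2 o) = just (mkState xs (x ∷ s1) s2 o)
exec E (mkState [] _ _ _) = nothing
exec N (mkState i (x ∷ s1) s2 o) = just (mkState i s1 (x ∷ s2) o)
exec N (mkState _ [] _ _) = nothing
exec C (mkState i s1 (x ∷ s2) o) = just (mkState i s1 s2 (o ++ [ x ]))
exec C (mkState _ _ [] _) = nothing

execs : List Op → State → Maybe State
execs [] st = just st
execs (o ∷ w) st with exec o st
... | nothing  = nothing
... | just st' = execs w st'

[1‥_] : ℕ → List ℕ
[1‥ n ] = applyUpTo suc n

-- A permutation of [n] is a list of naturals that is a rearrangement of
-- [1..n]; this is expressed in the statement via _↭_.

data DIRun (n : ℕ) : State → List Op → Set where
  finish : ∀ {st} → output st ≡ [1‥ n ] → DIRun n st []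
  step   : ∀ {st st' o w} → exec o st ≡ just st' →
           Linked (λ a b → b < a) (stack1 st') →
           Linked _<_ (stack2 st') →
           DIRun n st' w → DIRun n st (o ∷ w)

DIWord : ℕ → List ℕ → List Op → Set
DIWord n π w = DIRun n (initState π) w

DISortable : ℕ → List ℕ → Set
DISortable n π = Data.Product.Σ (List Op) (λ w → DIWord n π w)

elemᵇ : ℕ → List ℕ → Bool
elemᵇ v xs = any (λ x → x ≡ᵇ v) xs

notYetOutput : ℕ → List ℕ → List ℕ
notYetOutput n out = Data.List.filterᵇ (λ v → not (elemᵇ v out)) [1‥ n ]

rule1 : ℕ → State → Bool
rule1 n st with stack2 st | notYetOutput n (output st)
... | x ∷ _ | v ∷ _ = x ≡ᵇ v
... | _     | _     = false

rule2 : ℕ → State → Bool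
rule2 n st with stack1 st
... | [] = false
... | s1@(_ ∷ _) =
  let nxt = take (length s1) (notYetOutput n (output st)) in
  (length s1 ≡ᵇ length nxt)
    ∧ all (λ x → elemᵇ x nxt) s1
    ∧ all (λ x → elemᵇ x s1) nxt

rule3 : State → Bool
rule3 (mkState [] _ _ _) = false
rule3 (mkState (x ∷ _) s1 s2 _) = below s2 ∧ above s1
  where
  below : List ℕ → Bool
  below []      = true
  below (y ∷ _) = x <ᵇ y
  above : List ℕ → Bool
  above []      = true
  above (y ∷ _) = y <ᵇ x

runOps : List Op → State → Maybe (List Op × State)
runOps w st with execs w st
... | nothing  = nothing
... | just st' = just (w , st')

adiStage : ℕ → State → Maybe (List Op × State)
adiStage n st =
  if rule1 n st then runOps [ C ] st else
  if rule2 n st then runOps (replicate (length (stack1 st)) N) st else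
  if rule3 st then runOps [ E ] st else
  runOps [ N ] st

data ADIRun (n : ℕ) : State → List Op → Set where
  done  : ∀ {st} → input st ≡ [] → stack1 st ≡ [] → stack2 st ≡ [] →
          ADIRun n st []
  stage : ∀ {st st' ops w} → adiStage n st ≡ just (ops , st') →
          ADIRun n st' w → ADIRun n st (ops ++ w)

ADIWord : ℕ → List ℕ → List Op → Set
ADIWord n π w = ADIRun n (initState π) w

data Step : Set where
  sE sN sD : Step

-- T: replace each E N C^τ (maximal C block with its two preceding
-- letters) by a single N.  The Bool flag records that we are inside a
-- C block whose E N C prefix has already been replaced (so further C's
-- of that block are dropped).
toT′ : Bool → List Op → List Op
toT′ true  (C ∷ w)         = toT′ true w
toT′ _     (E ∷ N ∷ C ∷ w) = N ∷ toT′ true w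
toT′ _     (x ∷ w)         = x ∷ toT′ false w
toT′ _     []              = []

toT : List Op → List Op
toT = toT′ false

-- lengths τ₁,…,τ_k of the maximal blocks of C's, in order
-- (r = length of the current C run)
cBlocks′ : ℕ → List Op → List ℕ
cBlocks′ r       (C ∷ w) = cBlocks′ (suc r) w
cBlocks′ zero    (_ ∷ w) = cBlocks′ zero w
cBlocks′ (suc r) (_ ∷ w) = suc r ∷ cBlocks′ zero w
cBlocks′ zero    []      = []
cBlocks′ (suc r) []      = suc r ∷ []

cBlocks : List Op → List ℕ
cBlocks = cBlocks′ zero

partialSums : ℕ → List ℕ → List ℕ
partialSums acc []       = []
partialSums acc (t ∷ ts) = (acc + t) ∷ partialSums (acc + t) ts

-- S_D: the j-th N of T (1-indexed, j counted by `seen`) becomes D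
-- if j ∈ ℓs
markD : List ℕ → ℕ → List Op → List Step
markD ℓs seen []      = []
markD ℓs seen (E ∷ w) = sE ∷ markD ℓs seen w
markD ℓs seen (N ∷ w) =
  (if elemᵇ (suc seen) ℓs then sD else sN) ∷ markD ℓs (suc seen) w
markD ℓs seen (C ∷ w) = markD ℓs seen w  -- does not occur for ADI words

dropLast : {A : Set} → List A → List A
dropLast []           = []
dropLast (x ∷ [])     = []
dropLast (x ∷ y ∷ xs) = x ∷ dropLast (y ∷ xs)

Φ : List Op → List Step
Φ W = dropLast (markD (partialSums 0 (cBlocks W)) 0 (toT W))

endpoint : List Step → ℕ × ℕ
endpoint []       = 0 , 0
endpoint (sE ∷ p) = suc (proj₁ (endpoint p)) , proj₂ (endpoint p)
endpoint (sN ∷ p) = proj₁ (endpoint p) , suc (proj₂ (endpoint p))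
endpoint (sD ∷ p) = suc (proj₁ (endpoint p)) , suc (proj₂ (endpoint p))

SchroderPath : ℕ → List Step → Set
SchroderPath m p =
  ((k : ℕ) → proj₂ (endpoint (take k p)) ≤ proj₁ (endpoint (take k p)))
  × endpoint p ≡ (m , m)

module Submission where

-- The proof has two independent halves, joined by a grammar of "tokens".
-- An ADI word is spelled by three tokens: a push E (the entry stays on the
-- first stack), a move N, and a block E N C^(t+1), in which the next value
-- to output is read, transferred, and output together with t more values.
-- The relation Legal records which token words empty the machine.
--
-- (1) Combinatorics.  For a legal token word, T is the word of token
--     letters (E for a push, N otherwise), and the lengths τᵢ are the block
--     lengths.  Reading S_D from left to right, the distance x − y to the
--     diagonal equals the size of the first stack plus the number of D's
--     already placed ahead of their block (marked-walk), so S_D never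
--     crosses the diagonal, ends with D, and the remaining path S ends at
--     (n−1,n−1) (tokens-schroder).
-- (2) The algorithm.  Along the run, the machine holds exactly the values
--     not yet output, with ordered stacks (Invariant).  Outside blocks the
--     first stack is "guarded" by a smaller entry still in the input, so
--     rule (2) fires only right after the next value c+1 is read onto an
--     empty first stack; then rule (1) outputs a run of values.  This yields
--     the token decomposition of the ADI word (run-main).

open import Defs
open import Data.Nat using (ℕ; zero; suc; _+_; _∸_; _≤_; _<_; _>_; _≡ᵇ_; _<ᵇ_; _≤?_; _≟_; z≤n; s≤s)
open import Data.Nat.Properties
open import Data.Bool using (Bool; true; false; not; _∧_; if_then_else_; T; T?)
open import Data.Bool.Properties using (T-≡; ¬-not; ∧-zeroʳ)
open import Data.Bool.ListAction using (all)
open import Data.List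
  using (List; []; _∷_; _++_; [_]; length; take; replicate; map; head; applyUpTo; filterᵇ)
open import Data.List.Properties
  using (++-identityʳ; applyUpTo-∷ʳ; length-applyUpTo; filter-++; filter-none; filter-all)
open import Data.List.Relation.Unary.All as All using (All; _∷_)
open import Data.List.Relation.Unary.Any as Any using (here; there)
open import Data.List.Relation.Unary.Any.Properties using (any⁺; any⁻)
open import Data.List.Relation.Unary.Linked as Linked using (Linked; []; [-]; _∷_; _∷′_)
open import Data.List.Relation.Unary.Linked.Properties using (Linked⇒All)
open import Data.List.Membership.Propositional using (_∈_; _∉_)
open import Data.List.Membership.Propositional.Properties using (∈-++⁻; ∈-++⁺ˡ; ∈-++⁺ʳ)
open import Data.List.Relation.Binary.Permutation.Propositional using (_↭_; ↭-sym; ↭-trans)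
open import Data.List.Relation.Binary.Permutation.Propositional.Properties
  using (shift; drop-∷; ∈-resp-↭; ↭-length; ++⁺ˡ)
open import Data.Maybe using (just; nothing)
open import Data.Maybe.Relation.Binary.Connected as Connected
  using (Connected; just; just-nothing; nothing-just; nothing)
open import Data.Product using (∃-syntax; _×_; _,_; proj₁; proj₂)
open import Data.Sum using (_⊎_; inj₁; inj₂)
open import Data.Empty using (⊥-elim)
open import Function using (Equivalence; _∘_)
open import Relation.Nullary using (yes; no; ¬_)
open import Relation.Binary.PropositionalEquality
  using (_≡_; _≢_; refl; sym; trans; cong; cong₂; subst; module ≡-Reasoning)

≢⇒≡ᵇ-false : ∀ {x v} → x ≢ v → (x ≡ᵇ v) ≡ false
≢⇒≡ᵇ-false {x} {v} x≢v = ¬-not λ e → x≢v (≡ᵇ⇒≡ x v (Equivalence.from T-≡ e))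

∈⇒elemᵇ : ∀ {v xs} → v ∈ xs → elemᵇ v xs ≡ true
∈⇒elemᵇ {v} {xs} v∈ =
  Equivalence.to T-≡ (any⁺ (_≡ᵇ v) (Any.map (λ {x} v≡x → ≡⇒≡ᵇ x v (sym v≡x)) v∈))

∉⇒elemᵇ : ∀ {v xs} → v ∉ xs → elemᵇ v xs ≡ false
∉⇒elemᵇ {v} {xs} v∉ = ¬-not λ e →
  v∉ (Any.map (λ {x} t → sym (≡ᵇ⇒≡ x v t)) (any⁻ (_≡ᵇ v) xs (Equivalence.from T-≡ e)))

elemᵇ-skip : ∀ {x v} xs → x ≢ v → elemᵇ v (x ∷ xs) ≡ elemᵇ v xs
elemᵇ-skip {x} {v} xs x≢v rewrite ≢⇒≡ᵇ-false x≢v = refl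

increasing-above : ∀ {m L} → Linked _<_ (m ∷ L) → All (m <_) L
increasing-above [-] = All.[]
increasing-above (m<x ∷ inc) = Linked⇒All <-trans m<x inc

∉-below : ∀ {m v L} → Linked _<_ (m ∷ L) → v ≤ m → v ∉ L
∉-below inc v≤m v∈ = <⇒≱ (All.lookup (increasing-above inc) v∈) v≤m

-- An ADI word is a word in three tokens: a push E that is not
-- immediately moved on, a move N from the first to the second stack, and
-- a block E N C^(t+1) in which an entry is read, moved, and output
-- together with t further entries.
data Token : Set where
  push move : Token
  block : ℕ → Token

spell : List Token → List Op
spell []              = []
spell (push ∷ ts)     = E ∷ spell ts
spell (move ∷ ts)     = N ∷ spell ts
spell (block t ∷ ts)  = E ∷ N ∷ C ∷ (replicate t C ++ spell ts)

-- Legal i a b ts : the token word ts can be performed starting with i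
-- entries in the input, a on the first stack and b on the second, and
-- empties the machine.
data Legal : ℕ → ℕ → ℕ → List Token → Set where
  stop   : Legal 0 0 0 []
  pushed : ∀ {i a b ts} → Legal i (suc a) b ts → Legal (suc i) a b (push ∷ ts)
  moved  : ∀ {i a b ts} → Legal i a (suc b) ts → Legal i (suc a) b (move ∷ ts)
  block-run : ∀ {i a b b′ t ts} → b ≡ t + b′ → Legal i a b′ ts →
           Legal (suc i) a b (block t ∷ ts)

letterT : Token → Op
letterT push      = E
letterT move      = N
letterT (block _) = N

blockLengths : List Token → List ℕ
blockLengths []             = []
blockLengths (push ∷ ts)    = blockLengths ts
blockLengths (move ∷ ts)    = blockLengths ts
blockLengths (block t ∷ ts) = suc t ∷ blockLengths ts

-- The "inside a C block" flag of toT′ only matters in front of a C.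
toT′-E-flag : ∀ w → toT′ true (E ∷ w) ≡ toT′ false (E ∷ w)
toT′-E-flag []            = refl
toT′-E-flag (C ∷ w)       = refl
toT′-E-flag (E ∷ w)       = refl
toT′-E-flag (N ∷ [])      = refl
toT′-E-flag (N ∷ C ∷ w)   = refl
toT′-E-flag (N ∷ E ∷ w)   = refl
toT′-E-flag (N ∷ N ∷ w)   = refl

toT′-flag : ∀ ts → toT′ true (spell ts) ≡ toT′ false (spell ts)
toT′-flag []             = refl
toT′-flag (push ∷ ts)    = toT′-E-flag (spell ts)
toT′-flag (move ∷ ts)    = refl
toT′-flag (block t ∷ ts) = refl

-- A push is never followed by N C, so it survives into T.
toT-push : ∀ ts → toT (E ∷ spell ts) ≡ E ∷ toT (spell ts)
toT-push []                      = refl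
toT-push (push ∷ ts)             = refl
toT-push (block t ∷ ts)          = refl
toT-push (move ∷ [])             = refl
toT-push (move ∷ push ∷ ts)      = refl
toT-push (move ∷ move ∷ ts)      = refl
toT-push (move ∷ block t ∷ ts)   = refl

toT′-skipC : ∀ t w → toT′ true (replicate t C ++ w) ≡ toT′ true w
toT′-skipC zero    w = refl
toT′-skipC (suc t) w = toT′-skipC t w

toT-spell : ∀ ts → toT (spell ts) ≡ map letterT ts
toT-spell []             = refl
toT-spell (push ∷ ts)    = trans (toT-push ts) (cong (E ∷_) (toT-spell ts))
toT-spell (move ∷ ts)    = cong (N ∷_) (toT-spell ts)
toT-spell (block t ∷ ts) =
  cong (N ∷_) (trans (toT′-skipC t (spell ts)) (trans (toT′-flag ts) (toT-spell ts)))

cBlocks′-skipC : ∀ t r w → cBlocks′ r (replicate t C ++ w) ≡ cBlocks′ (t + r) w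
cBlocks′-skipC zero    r w = refl
cBlocks′-skipC (suc t) r w =
  trans (cBlocks′-skipC t (suc r) w) (cong (λ k → cBlocks′ k w) (+-suc t r))

mutual
  cBlocks-spell : ∀ ts → cBlocks (spell ts) ≡ blockLengths ts
  cBlocks-spell []             = refl
  cBlocks-spell (push ∷ ts)    = cBlocks-spell ts
  cBlocks-spell (move ∷ ts)    = cBlocks-spell ts
  cBlocks-spell (block t ∷ ts) =
    trans (cBlocks′-skipC t 1 (spell ts))
          (trans (cong (λ k → cBlocks′ k (spell ts)) (+-comm t 1)) (cBlocks-run t ts))

  cBlocks-run : ∀ r ts → cBlocks′ (suc r) (spell ts) ≡ suc r ∷ blockLengths ts
  cBlocks-run r []             = refl
  cBlocks-run r (push ∷ ts)    = cong (suc r ∷_) (cBlocks-spell ts)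
  cBlocks-run r (move ∷ ts)    = cong (suc r ∷_) (cBlocks-spell ts)
  cBlocks-run r (block t ∷ ts) = cong (suc r ∷_) (cBlocks-spell (block t ∷ ts))

-- The marks ℓᵢ of a token word whose earlier blocks output acc entries.
marks : ℕ → List Token → List ℕ
marks acc ts = partialSums acc (blockLengths ts)

marks-increasing : ∀ acc ts → Linked _<_ (acc ∷ marks acc ts)
marks-increasing acc []             = [-]
marks-increasing acc (push ∷ ts)    = marks-increasing acc ts
marks-increasing acc (move ∷ ts)    = marks-increasing acc ts
marks-increasing acc (block t ∷ ts) = m<m+n acc (s≤s z≤n) ∷ marks-increasing (acc + suc t) ts

-- pending s L : how many of the leading marks of L have already been
-- reached after s letters N; these are the D's placed ahead of their block.
pending : ℕ → List ℕ → ℕ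
pending s []       = 0
pending s (x ∷ xs) with x ≤? s
... | yes _ = suc (pending s xs)
... | no  _ = 0

pending-zero : ∀ {m} s L → Linked _<_ (m ∷ L) → s ≤ m → pending s L ≡ 0
pending-zero s []       _   _   = refl
pending-zero s (x ∷ xs) inc s≤m with x ≤? s
... | yes x≤s = ⊥-elim (<⇒≱ (Linked.head inc) (≤-trans x≤s s≤m))
... | no  _   = refl

pending-step : ∀ {m} s L → Linked _<_ (m ∷ L) →
  (elemᵇ (suc s) L ≡ true  × pending (suc s) L ≡ suc (pending s L)) ⊎
  (elemᵇ (suc s) L ≡ false × pending (suc s) L ≡ pending s L)
pending-step s []       _   = inj₂ (refl , refl)
pending-step s (x ∷ xs) inc with x ≤? s | x ≤? suc s
... | yes x≤s | no x≰1+s = ⊥-elim (x≰1+s (m≤n⇒m≤1+n x≤s))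
... | yes x≤s | yes _
  rewrite elemᵇ-skip {x} {suc s} xs (<⇒≢ (s≤s x≤s))
  with pending-step s xs (Linked.tail inc)
...   | inj₁ (el , pe) = inj₁ (el , cong suc pe)
...   | inj₂ (el , pe) = inj₂ (el , cong suc pe)
pending-step s (x ∷ xs) inc | no x≰s | yes x≤1+s =
  inj₁ (∈⇒elemᵇ {xs = x ∷ xs} (here (sym x≡1+s)) ,
        cong suc (pending-zero (suc s) xs (Linked.tail inc) (≤-reflexive (sym x≡1+s))))
  where x≡1+s = ≤-antisym x≤1+s (≰⇒> x≰s)
pending-step s (x ∷ xs) inc | no x≰s | no x≰1+s =
  inj₂ (∉⇒elemᵇ {xs = x ∷ xs} (∉-below (≰⇒> x≰1+s ∷ Linked.tail inc) ≤-refl) , refl)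

pending-passed : ∀ {h s} L → h ≤ s → pending s (h ∷ L) ≡ suc (pending s L)
pending-passed {h} {s} L h≤s with h ≤? s
... | yes _   = refl
... | no h≰s = ⊥-elim (h≰s h≤s)

markD-drop : ∀ {h} L s w → h ≤ s → markD (h ∷ L) s w ≡ markD L s w
markD-drop L s []      h≤s = refl
markD-drop L s (E ∷ w) h≤s = cong (sE ∷_) (markD-drop L s w h≤s)
markD-drop L s (N ∷ w) h≤s rewrite elemᵇ-skip L (<⇒≢ (s≤s h≤s)) =
  cong (_ ∷_) (markD-drop L (suc s) w (m≤n⇒m≤1+n h≤s))
markD-drop L s (C ∷ w) h≤s = markD-drop L s w h≤s

-- Walk d S : starting d steps below the diagonal (d = x − y), the path S
-- never rises above the diagonal and ends on it.
data Walk : ℕ → List Step → Set where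
  end   : Walk 0 []
  right : ∀ {d S} → Walk (suc d) S → Walk d (sE ∷ S)
  up    : ∀ {d S} → Walk d S → Walk (suc d) (sN ∷ S)
  diag  : ∀ {d S} → Walk d S → Walk d (sD ∷ S)

mark-step : ∀ {m} d s L {S} → Linked _<_ (m ∷ L) → Walk (d + pending (suc s) L) S →
  Walk (suc (d + pending s L)) ((if elemᵇ (suc s) L then sD else sN) ∷ S)
mark-step d s L {S} inc w with pending-step s L inc
... | inj₁ (el , pe) rewrite el =
  diag (subst (λ h → Walk h S) (trans (cong (d +_) pe) (+-suc d (pending s L))) w)
... | inj₂ (el , pe) rewrite el = up (subst (λ h → Walk h S) (cong (d +_) pe) w)

Closes : ℕ → List Step → Set
Closes h P = ∃[ S ] (P ≡ S ++ [ sD ] × Walk h S)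

block-count : ∀ acc t b′ → (acc + suc t) + b′ ≡ suc (acc + (t + b′))
block-count acc t b′ = trans (+-assoc acc (suc t) b′) (+-suc acc (t + b′))

-- Suppose seen letters N of T have
-- been read and the blocks so far have output acc values, so that the
-- second stack holds b = seen − acc entries.  Then the rest of S_D closes at
-- height (entries on the first stack) + (D's already placed ahead of their
-- block).
marked-walk : ∀ {i a b t ts} → Legal i a b (t ∷ ts) → ∀ acc seen → acc + b ≡ seen →
  Closes (a + pending seen (marks acc (t ∷ ts)))
         (markD (marks acc (t ∷ ts)) seen (map letterT (t ∷ ts)))
marked-walk (pushed {ts = u ∷ ts} p) acc seen e with marked-walk p acc seen e
... | S , eq , w = sE ∷ S , cong (sE ∷_) eq , right w
marked-walk {a = suc a} {b = b} (moved {ts = u ∷ ts} p) acc seen e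
  with marked-walk p acc (suc seen) (trans (+-suc acc b) (cong suc e))
... | S , eq , w =
  _ ∷ S , cong (_ ∷_) eq , mark-step a seen (marks acc (u ∷ ts)) (marks-increasing acc (u ∷ ts)) w
marked-walk {b = b} (block-run {b′ = b′} {t = t} {ts = ts} b≡ p) acc seen e =
  closes-block b′ ts p (trans (block-count acc t b′) (cong suc (trans (cong (acc +_) (sym b≡)) e)))
  where
  -- The block's letter N is the (seen+1)-st; its mark h = acc + t + 1 is
  -- met right here when the block empties the second stack (b′ = 0), and
  -- was already passed (its D placed ahead) otherwise.
  h = acc + suc t
  closes-block : ∀ {i a} b′ ts → Legal i a b′ ts → h + b′ ≡ suc seen →
    Closes (a + pending seen (h ∷ marks h ts)) (markD (h ∷ marks h ts) seen (N ∷ map letterT ts))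
  closes-block zero [] stop h≡ with trans (sym (+-identityʳ h)) h≡
  ... | h≡′
    rewrite ∈⇒elemᵇ {xs = h ∷ []} (here (sym h≡′))
          | pending-zero seen (h ∷ []) (≤-reflexive (sym h≡′) ∷ [-]) ≤-refl
    = [] , refl , end
  closes-block {a = a} zero (u ∷ ts) p h≡
    with trans (sym (+-identityʳ h)) h≡ | marked-walk p h (suc seen) h≡
  ... | h≡′ | S , eq , w
    rewrite ∈⇒elemᵇ {xs = h ∷ marks h (u ∷ ts)} (here (sym h≡′))
          | markD-drop (marks h (u ∷ ts)) (suc seen) (map letterT (u ∷ ts)) (≤-reflexive h≡′)
          | pending-zero seen (h ∷ marks h (u ∷ ts))
                         (≤-reflexive (sym h≡′) ∷ marks-increasing h (u ∷ ts)) ≤-refl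
    = sD ∷ S , cong (sD ∷_) eq , diag (subst (λ k → Walk (a + k) S) pending-after w)
    where
    pending-after : pending (suc seen) (marks h (u ∷ ts)) ≡ 0
    pending-after = pending-zero (suc seen) _ (marks-increasing h (u ∷ ts)) (≤-reflexive (sym h≡′))
  closes-block {a = a} (suc b″) (u ∷ ts) p h≡
    with subst (h ≤_) (suc-injective (trans (sym (+-suc h b″)) h≡)) (m≤m+n h b″)
       | marked-walk p h (suc seen) h≡
  ... | h≤seen | S , eq , w
    rewrite elemᵇ-skip (marks h (u ∷ ts)) (<⇒≢ (s≤s h≤seen))
          | markD-drop (marks h (u ∷ ts)) (suc seen) (map letterT (u ∷ ts)) (m≤n⇒m≤1+n h≤seen)
          | pending-passed (marks h (u ∷ ts)) h≤seen
    = mark ∷ S , cong (mark ∷_) eq ,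
      subst (λ k → Walk k (mark ∷ S)) (sym (+-suc a _))
            (mark-step a seen L′ (marks-increasing h (u ∷ ts)) w)
    where
    L′ = marks h (u ∷ ts)
    mark = if elemᵇ (suc seen) L′ then sD else sN

X Y : List Step → ℕ
X P = proj₁ (endpoint P)
Y P = proj₂ (endpoint P)

walk-below : ∀ {d S} → Walk d S → ∀ k → Y (take k S) ≤ d + X (take k S)
walk-below w         zero    = z≤n
walk-below end       (suc k) = z≤n
walk-below {d} (right {S = S} w) (suc k) =
  subst (Y (take k S) ≤_) (sym (+-suc d (X (take k S)))) (walk-below w k)
walk-below (up w)    (suc k) = s≤s (walk-below w k)
walk-below {d} (diag {S = S} w) (suc k) =
  subst (suc (Y (take k S)) ≤_) (sym (+-suc d (X (take k S)))) (s≤s (walk-below w k))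

walk-end : ∀ {d S} → Walk d S → d + X S ≡ Y S
walk-end end                         = refl
walk-end {d} (right {S = S} w)       = trans (+-suc d (X S)) (walk-end w)
walk-end (up w)                      = cong suc (walk-end w)
walk-end {d} (diag {S = S} w)        = trans (+-suc d (X S)) (cong suc (walk-end w))

walk-schroder : ∀ {m S} → Walk 0 S → Y S ≡ m → SchroderPath m S
walk-schroder w y = walk-below w , cong₂ _,_ (trans (walk-end w) y) y

Y-snoc-D : ∀ S → Y (S ++ [ sD ]) ≡ suc (Y S)
Y-snoc-D []       = refl
Y-snoc-D (sE ∷ S) = Y-snoc-D S
Y-snoc-D (sN ∷ S) = cong suc (Y-snoc-D S)
Y-snoc-D (sD ∷ S) = cong suc (Y-snoc-D S)

dropLast-snoc : ∀ {A : Set} (S : List A) x → dropLast (S ++ [ x ]) ≡ S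
dropLast-snoc []          x = refl
dropLast-snoc (y ∷ [])    x = refl
dropLast-snoc (y ∷ z ∷ S) x = cong (y ∷_) (dropLast-snoc (z ∷ S) x)

Y-mark : ∀ c S → Y ((if c then sD else sN) ∷ S) ≡ suc (Y S)
Y-mark true  S = refl
Y-mark false S = refl

-- Every entry read is eventually moved, so T has i + a letters N.
Y-markD : ∀ {i a b ts} → Legal i a b ts → ∀ L s → Y (markD L s (map letterT ts)) ≡ i + a
Y-markD stop                  L s = refl
Y-markD {suc i} {a} (pushed p) L s = trans (Y-markD p L s) (+-suc i a)
Y-markD {i} {suc a} (moved p) L s =
  trans (Y-mark (elemᵇ (suc s) L) _) (trans (cong suc (Y-markD p L (suc s))) (sym (+-suc i a)))
Y-markD (block-run _ p)          L s =
  trans (Y-mark (elemᵇ (suc s) L) _) (cong suc (Y-markD p L (suc s)))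

tokens-schroder : ∀ {n ts} → 0 < n → Legal n 0 0 ts → SchroderPath (n ∸ 1) (Φ (spell ts))
tokens-schroder {ts = []} () stop
tokens-schroder {n} {t ∷ ts} _ legal
  rewrite cBlocks-spell (t ∷ ts) | toT-spell (t ∷ ts)
  with marked-walk legal 0 0 refl
... | S , eq , w rewrite eq | dropLast-snoc S sD = walk-schroder from-diagonal y-end
  where
  from-diagonal : Walk 0 S
  from-diagonal = subst (λ h → Walk h S) (pending-zero 0 _ (marks-increasing 0 (t ∷ ts)) z≤n) w
  y-end : Y S ≡ n ∸ 1
  y-end = cong (_∸ 1) (begin
    suc (Y S)                                          ≡⟨ Y-snoc-D S ⟨
    Y (S ++ [ sD ])                                    ≡⟨ cong Y eq ⟨
    Y (markD (marks 0 (t ∷ ts)) 0 (map letterT (t ∷ ts))) ≡⟨ Y-markD legal _ 0 ⟩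
    n + 0                                              ≡⟨ +-identityʳ n ⟩
    n                                                  ∎)
    where open ≡-Reasoning

interval : ℕ → ℕ → List ℕ
interval k zero    = []
interval k (suc m) = k ∷ interval (suc k) m

applyUpTo-interval : ∀ (f : ℕ → ℕ) k m → (∀ x → f x ≡ k + x) → applyUpTo f m ≡ interval k m
applyUpTo-interval f k zero    f≗ = refl
applyUpTo-interval f k (suc m) f≗ =
  cong₂ _∷_ (trans (f≗ 0) (+-identityʳ k))
            (applyUpTo-interval (f ∘ suc) (suc k) m (λ x → trans (f≗ (suc x)) (+-suc k x)))

[1‥]-interval : ∀ n → [1‥ n ] ≡ interval 1 n
[1‥]-interval n = applyUpTo-interval suc 1 n (λ _ → refl)

interval-++ : ∀ k a b → interval k (a + b) ≡ interval k a ++ interval (k + a) b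
interval-++ k zero    b rewrite +-identityʳ k = refl
interval-++ k (suc a) b rewrite +-suc k a = cong (k ∷_) (interval-++ (suc k) a b)

∈-interval : ∀ {v} k m → v ∈ interval k m → k ≤ v × v < k + m
∈-interval k (suc m) (here refl) = ≤-refl , subst (k <_) (sym (+-suc k m)) (s≤s (m≤m+n k m))
∈-interval {v} k (suc m) (there v∈) with ∈-interval (suc k) m v∈
... | k<v , v<k+m = <⇒≤ k<v , subst (v <_) (sym (+-suc k m)) v<k+m

remaining-values : ∀ c r → notYetOutput (c + r) [1‥ c ] ≡ interval (suc c) r
remaining-values c r = begin
  filterᵇ fresh [1‥ c + r ]
    ≡⟨ cong (filterᵇ fresh) (trans ([1‥]-interval (c + r)) (interval-++ 1 c r)) ⟩
  filterᵇ fresh (interval 1 c ++ interval (suc c) r)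
    ≡⟨ filter-++ (T? ∘ fresh) (interval 1 c) (interval (suc c) r) ⟩
  filterᵇ fresh (interval 1 c) ++ filterᵇ fresh (interval (suc c) r)
    ≡⟨ cong₂ _++_ (filter-none (T? ∘ fresh) (All.tabulate already-output))
                  (filter-all (T? ∘ fresh) (All.tabulate unseen)) ⟩
  interval (suc c) r ∎
  where
  open ≡-Reasoning
  fresh : ℕ → Bool
  fresh v = not (elemᵇ v [1‥ c ])
  already-output : ∀ {v} → v ∈ interval 1 c → ¬ T (fresh v)
  already-output {v} v∈ rewrite ∈⇒elemᵇ (subst (v ∈_) (sym ([1‥]-interval c)) v∈) = λ ()
  not-yet-output : ∀ {v} → v ∈ interval (suc c) r → v ∉ [1‥ c ]
  not-yet-output v∈ v∈′ = <⇒≱ (proj₂ (∈-interval 1 c (subst (_ ∈_) ([1‥]-interval c) v∈′)))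
                              (proj₁ (∈-interval (suc c) r v∈))
  unseen : ∀ {v} → v ∈ interval (suc c) r → T (fresh v)
  unseen v∈ rewrite ∉⇒elemᵇ (not-yet-output v∈) = _

contents : State → List ℕ
contents st = input st ++ stack1 st ++ stack2 st

in-input : ∀ {v : ℕ} {i} s1 s2 → v ∈ i → v ∈ i ++ s1 ++ s2
in-input s1 s2 = ∈-++⁺ˡ

in-stack2 : ∀ {v : ℕ} {s2} i s1 → v ∈ s2 → v ∈ i ++ s1 ++ s2
in-stack2 i s1 v∈ = ∈-++⁺ʳ i (∈-++⁺ʳ s1 v∈)

record Invariant (n c r : ℕ) (st : State) : Set where
  constructor invariant
  field
    total      : c + r ≡ n
    printed    : output st ≡ [1‥ c ]
    remaining  : contents st ↭ interval (suc c) r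
    decreasing : Linked _>_ (stack1 st)
    increasing : Linked _<_ (stack2 st)
    tops       : Connected _<_ (head (stack1 st)) (head (stack2 st))

initial-invariant : ∀ {n π} → π ↭ [1‥ n ] → Invariant n 0 n (initState π)
initial-invariant {n} {π} π↭ = invariant refl refl remaining [] [] nothing
  where
  remaining : π ++ [] ++ [] ↭ interval 1 n
  remaining rewrite ++-identityʳ π = subst (π ↭_) ([1‥]-interval n) π↭

in-machine : ∀ {n c r st v} → Invariant n c r st → v ∈ contents st → suc c ≤ v
in-machine I v∈ = proj₁ (∈-interval _ _ (∈-resp-↭ (Invariant.remaining I) v∈))

nothing-left : ∀ {n c st v} → Invariant n c 0 st → v ∉ contents st
nothing-left I v∈ with ∈-resp-↭ (Invariant.remaining I) v∈
... | ()

push-invariant : ∀ {n c r x i s1 s2 o} → Invariant n c r (mkState (x ∷ i) s1 s2 o) →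
  Connected _<_ (head s1) (just x) → Connected _<_ (just x) (head s2) →
  Invariant n c r (mkState i (x ∷ s1) s2 o)
push-invariant {x = x} {i} {s1} {s2} (invariant tot pr rem dec inc _) below above =
  invariant tot pr (↭-trans (shift x i (s1 ++ s2)) rem)
            (Connected.sym (λ p → p) below ∷′ dec) inc above

move-invariant : ∀ {n c r t i s1 s2 o} → Invariant n c r (mkState i (t ∷ s1) s2 o) →
  Invariant n c r (mkState i s1 (t ∷ s2) o)
move-invariant {t = t} {i} {s1} {s2} (invariant tot pr rem dec inc tp) =
  invariant tot pr (↭-trans (++⁺ˡ i (shift t s1 s2)) rem) (Linked.tail dec) (tp ∷′ inc)
            (Connected.sym (λ p → p) (Linked.head′ dec))

pop-invariant : ∀ {n c r i s2 o} → Invariant n c (suc r) (mkState i [] (suc c ∷ s2) o) →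
  Invariant n (suc c) r (mkState i [] s2 (o ++ [ suc c ]))
pop-invariant {c = c} {r} {i} {s2} (invariant tot pr rem _ inc _) =
  invariant (trans (sym (+-suc c r)) tot)
            (trans (cong (_++ [ suc c ]) pr) (applyUpTo-∷ʳ suc c))
            (drop-∷ (↭-trans (↭-sym (shift (suc c) i s2)) rem))
            [] (Linked.tail inc) (empty-below s2)
  where
  empty-below : ∀ s → Connected _<_ nothing (head s)
  empty-below []      = nothing
  empty-below (_ ∷ _) = nothing-just

topRule : List ℕ → List ℕ → Bool
topRule (x ∷ _) (v ∷ _) = x ≡ᵇ v
topRule _       _       = false

rule1-topRule : ∀ n i s1 s2 o → rule1 n (mkState i s1 s2 o) ≡ topRule s2 (notYetOutput n o)
rule1-topRule n i s1 []       o = refl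
rule1-topRule n i s1 (x ∷ s2) o with notYetOutput n o
... | []    = refl
... | _ ∷ _ = refl

-- Rule (1) only looks at the second stack and the output, so reading an
-- entry does not affect it.
rule1-read : ∀ n x i s1 s2 o → rule1 n (mkState i (x ∷ s1) s2 o) ≡ rule1 n (mkState (x ∷ i) s1 s2 o)
rule1-read n x i s1 s2 o =
  trans (rule1-topRule n i (x ∷ s1) s2 o) (sym (rule1-topRule n (x ∷ i) s1 s2 o))

rule1-eval : ∀ {n c r i s1 s2 o} → Invariant n c r (mkState i s1 s2 o) →
  rule1 n (mkState i s1 s2 o) ≡ topRule s2 (interval (suc c) r)
rule1-eval {c = c} {r} {i} {s1} {s2} (invariant refl refl _ _ _ _) =
  trans (rule1-topRule (c + r) i s1 s2 [1‥ c ]) (cong (topRule s2) (remaining-values c r))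

rule1-next : ∀ {n c r i s1 s2 o} → Invariant n c (suc r) (mkState i s1 (suc c ∷ s2) o) →
  rule1 n (mkState i s1 (suc c ∷ s2) o) ≡ true
rule1-next {c = c} I = trans (rule1-eval I) (Equivalence.to T-≡ (≡⇒≡ᵇ (suc c) (suc c) refl))

rule1-above : ∀ {n c r t i s1 s2 o} → Invariant n c r (mkState i s1 (t ∷ s2) o) → suc c < t →
  rule1 n (mkState i s1 (t ∷ s2) o) ≡ false
rule1-above {r = zero}  I _  = rule1-eval I
rule1-above {r = suc r} I c<t = trans (rule1-eval I) (≢⇒≡ᵇ-false (>⇒≢ c<t))

rule1-fires : ∀ {n c r i s1 s2 o} → Invariant n c r (mkState i s1 s2 o) →
  rule1 n (mkState i s1 s2 o) ≡ true → ∃[ s2′ ] ∃[ r′ ] (s2 ≡ suc c ∷ s2′ × r ≡ suc r′)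
rule1-fires {c = c} {r} {s2 = s2} I r1 = top-is-next s2 r (trans (sym (rule1-eval I)) r1)
  where
  top-is-next : ∀ s2 r → topRule s2 (interval (suc c) r) ≡ true →
    ∃[ s2′ ] ∃[ r′ ] (s2 ≡ suc c ∷ s2′ × r ≡ suc r′)
  top-is-next (x ∷ s2′) (suc r′) t =
    s2′ , r′ , cong (_∷ s2′) (≡ᵇ⇒≡ x (suc c) (Equivalence.from T-≡ t)) , refl

-- When rule (1) does not fire, c+1 is not on the second stack at all,
-- since that stack increases and holds only values ≥ c+1.
next-not-stacked : ∀ {n c r i s1 s2 o} → Invariant n c r (mkState i s1 s2 o) →
  rule1 n (mkState i s1 s2 o) ≡ false → suc c ∉ s2
next-not-stacked {r = zero} {i = i} {s1} I r1 c∈ = nothing-left I (in-stack2 i s1 c∈)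
next-not-stacked {r = suc r} {s2 = y ∷ s2} I r1 (here refl) with trans (sym r1) (rule1-next I)
... | ()
next-not-stacked {r = suc r} {i = i} {s1} {y ∷ s2} I r1 (there c∈) =
  <⇒≱ (All.lookup (increasing-above (Invariant.increasing I)) c∈)
      (in-machine I (in-stack2 i s1 (here refl)))

-- stack1 is guarded: empty, or some entry still in the input is below all
-- of it.  A guarded first stack never holds the next value to output.
Guarded : State → Set
Guarded st = stack1 st ≡ [] ⊎ ∃[ w ] (w ∈ input st × All (w <_) (stack1 st))

nextBlock : List ℕ → List ℕ → Bool
nextBlock s1 nyo =
  let nxt = take (length s1) nyo in
  (length s1 ≡ᵇ length nxt) ∧ all (λ x → elemᵇ x nxt) s1 ∧ all (λ x → elemᵇ x s1) nxt

rule2-nextBlock : ∀ {n c r i z s1 s2 o} → Invariant n c r (mkState i (z ∷ s1) s2 o) →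
  rule2 n (mkState i (z ∷ s1) s2 o) ≡ nextBlock (z ∷ s1) (interval (suc c) r)
rule2-nextBlock {c = c} {r} {z = z} {s1} (invariant refl refl _ _ _ _) =
  cong (nextBlock (z ∷ s1)) (remaining-values c r)

nextBlock-missing : ∀ {v} z s1 vs → v ∉ z ∷ s1 → nextBlock (z ∷ s1) (v ∷ vs) ≡ false
nextBlock-missing {v} z s1 vs v∉ =
  trans (cong (λ e → lengths ∧ covered ∧ (e ∧ all (λ x → elemᵇ x (z ∷ s1)) (take (length s1) vs)))
              (∉⇒elemᵇ v∉))
        (trans (cong (lengths ∧_) (∧-zeroʳ covered)) (∧-zeroʳ lengths))
  where
  nxt = take (length (z ∷ s1)) (v ∷ vs)
  lengths = length (z ∷ s1) ≡ᵇ length nxt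
  covered = all (λ x → elemᵇ x nxt) (z ∷ s1)

rule2-guarded : ∀ {n c r i s1 s2 o} → Invariant n c r (mkState i s1 s2 o) →
  Guarded (mkState i s1 s2 o) → rule2 n (mkState i s1 s2 o) ≡ false
rule2-guarded {s1 = []} _ _ = refl
rule2-guarded {s1 = _ ∷ _} _ (inj₁ ())
rule2-guarded {r = zero} {s1 = _ ∷ _} I (inj₂ _) = rule2-nextBlock I
rule2-guarded {r = suc r} {i = i} {z ∷ s1} {s2} I (inj₂ (w , w∈ , w<s1)) =
  trans (rule2-nextBlock I) (nextBlock-missing z s1 _ c∉)
  where
  c∉ : _ ∉ z ∷ s1
  c∉ c∈ = <⇒≱ (All.lookup w<s1 c∈) (in-machine I (in-input (z ∷ s1) s2 w∈))

rule2-single : ∀ {n c r i s2 o} → Invariant n c (suc r) (mkState i (suc c ∷ []) s2 o) →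
  rule2 n (mkState i (suc c ∷ []) s2 o) ≡ true
rule2-single {c = c} I rewrite rule2-nextBlock I | ∈⇒elemᵇ {suc c} {suc c ∷ []} (here refl) = refl

∧-trueˡ : ∀ {a b} → a ∧ b ≡ true → a ≡ true
∧-trueˡ {true} _ = refl

∧-trueʳ : ∀ {a b} → a ∧ b ≡ true → b ≡ true
∧-trueʳ {true} b≡ = b≡

<ᵇ-true : ∀ {m n} → (m <ᵇ n) ≡ true → m < n
<ᵇ-true {m} {n} e = <ᵇ⇒< m n (Equivalence.from T-≡ e)

rule3-fits : ∀ {x i s1 s2 o} → rule3 (mkState (x ∷ i) s1 s2 o) ≡ true →
  Connected _<_ (head s1) (just x) × Connected _<_ (just x) (head s2)
rule3-fits {s1 = []}    {[]}    r3 = nothing-just , just-nothing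
rule3-fits {s1 = []}    {y ∷ _} r3 = nothing-just , just (<ᵇ-true (∧-trueˡ r3))
rule3-fits {s1 = z ∷ _} {[]}    r3 = just (<ᵇ-true r3) , just-nothing
rule3-fits {s1 = z ∷ _} {y ∷ _} r3 = just (<ᵇ-true (∧-trueʳ r3)) , just (<ᵇ-true (∧-trueˡ r3))

stage-output : ∀ {n st} → rule1 n st ≡ true → adiStage n st ≡ runOps [ C ] st
stage-output r1 rewrite r1 = refl

stage-transfer : ∀ {n st} → rule1 n st ≡ false → rule2 n st ≡ true →
  adiStage n st ≡ runOps (replicate (length (stack1 st)) N) st
stage-transfer r1 r2 rewrite r1 | r2 = refl

stage-read : ∀ {n st} → rule1 n st ≡ false → rule2 n st ≡ false → rule3 st ≡ true →
  adiStage n st ≡ runOps [ E ] st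
stage-read r1 r2 r3 rewrite r1 | r2 | r3 = refl

stage-move : ∀ {n st} → rule1 n st ≡ false → rule2 n st ≡ false → rule3 st ≡ false →
  adiStage n st ≡ runOps [ N ] st
stage-move r1 r2 r3 rewrite r1 | r2 | r3 = refl

push-guard : ∀ {n c r x i s1 s2 o} → Invariant n c r (mkState (x ∷ i) s1 s2 o) →
  rule1 n (mkState (x ∷ i) s1 s2 o) ≡ false → Guarded (mkState (x ∷ i) s1 s2 o) →
  Connected _<_ (head s1) (just x) →
  (s1 ≡ [] × x ≡ suc c) ⊎ Guarded (mkState i (x ∷ s1) s2 o)
push-guard {s1 = _ ∷ _} I r1 (inj₁ ()) _
push-guard {x = x} {i} {z ∷ s1} I r1 (inj₂ (w , w∈ , w<z ∷ w<s1)) (just z<x) =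
  inj₂ (inj₂ (w , still-input w∈ , w<x ∷ w<z ∷ w<s1))
  where
  w<x = <-trans w<z z<x
  still-input : w ∈ x ∷ i → w ∈ i
  still-input (here w≡x) = ⊥-elim (<⇒≢ w<x w≡x)
  still-input (there w∈i) = w∈i
push-guard {c = c} {x = x} {s1 = []} I r1 _ _ with x ≟ suc c
... | yes x≡ = inj₁ (refl , x≡)
push-guard {r = zero} {s1 = []} I r1 _ _ | no _ = ⊥-elim (nothing-left I (here refl))
push-guard {c = c} {suc r} {x} {i} {[]} {s2} I r1 _ _ | no x≢ =
  inj₂ (inj₂ (suc c , next-in-input , ≤∧≢⇒< (in-machine I (here refl)) (λ e → x≢ (sym e)) ∷ All.[]))
  where
  next-in-input : suc c ∈ i
  next-in-input with ∈-++⁻ (x ∷ i) (∈-resp-↭ (↭-sym (Invariant.remaining I)) (here refl))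
  ... | inj₁ (here c≡x)   = ⊥-elim (x≢ (sym c≡x))
  ... | inj₁ (there c∈i) = c∈i
  ... | inj₂ c∈s2        = ⊥-elim (next-not-stacked I r1 c∈s2)

-- A Boolean case split that, unlike `with`, leaves the types of other
-- hypotheses untouched.
true-or-false : ∀ b → b ≡ true ⊎ b ≡ false
true-or-false true  = inj₁ refl
true-or-false false = inj₂ refl

Tokenised : State → List Op → Set
Tokenised st w = ∃[ ts ]
  (w ≡ spell ts × Legal (length (input st)) (length (stack1 st)) (length (stack2 st)) ts)

BlockTail : State → List Op → Set
BlockTail st w = ∃[ t ] ∃[ ts ] ∃[ b′ ]
  (w ≡ C ∷ (replicate t C ++ spell ts) × length (stack2 st) ≡ suc (t + b′) ×
   Legal (length (input st)) 0 b′ ts)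

mutual
  run-main : ∀ {n c r st w} → Invariant n c r st → rule1 n st ≡ false → Guarded st →
    ADIRun n st w → Tokenised st w
  run-main {st = mkState _ _ _ _} I r1 g (done refl refl refl) = [] , refl , stop
  run-main {st = mkState [] s1 s2 o} I r1 g (stage eq rest) = run-move I r1 g refl eq rest
  run-main {st = mkState (x ∷ i) s1 s2 o} I r1 g (stage eq rest)
    with true-or-false (rule3 (mkState (x ∷ i) s1 s2 o))
  ... | inj₁ r3 = run-read I r1 g r3 eq rest
  ... | inj₂ r3 = run-move I r1 g r3 eq rest

  -- Rule (4): the top t of the first stack moves on; the guard w < t keeps
  -- rule (1) from firing.
  run-move : ∀ {n c r i s1 s2 o ops st′ w} → Invariant n c r (mkState i s1 s2 o) →
    rule1 n (mkState i s1 s2 o) ≡ false → Guarded (mkState i s1 s2 o) →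
    rule3 (mkState i s1 s2 o) ≡ false →
    adiStage n (mkState i s1 s2 o) ≡ just (ops , st′) → ADIRun n st′ w →
    Tokenised (mkState i s1 s2 o) (ops ++ w)
  run-move {n} {i = i} {s1} {s2} {o} I r1 g r3 eq rest
    with trans (sym eq) (stage-move {n} {mkState i s1 s2 o} r1 (rule2-guarded I g) r3)
  run-move {s1 = []}    I r1 g r3 eq rest | ()
  run-move {s1 = _ ∷ _} I r1 (inj₁ ()) r3 eq rest | _
  run-move {i = i} {t ∷ s1} {s2} I r1 (inj₂ (w , w∈ , w<t ∷ w<s1)) r3 eq rest | refl
    with run-main I′ (rule1-above I′ (≤-<-trans (in-machine I (in-input (t ∷ s1) s2 w∈)) w<t))
                  (inj₂ (w , w∈ , w<s1)) rest
    where I′ = move-invariant I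
  ... | ts , refl , legal = move ∷ ts , refl , moved legal

  run-read : ∀ {n c r x i s1 s2 o ops st′ w} → Invariant n c r (mkState (x ∷ i) s1 s2 o) →
    rule1 n (mkState (x ∷ i) s1 s2 o) ≡ false → Guarded (mkState (x ∷ i) s1 s2 o) →
    rule3 (mkState (x ∷ i) s1 s2 o) ≡ true →
    adiStage n (mkState (x ∷ i) s1 s2 o) ≡ just (ops , st′) → ADIRun n st′ w →
    Tokenised (mkState (x ∷ i) s1 s2 o) (ops ++ w)
  run-read {n} {x = x} {i} {s1} {s2} {o} I r1 g r3 eq rest
    with trans (sym eq) (stage-read {n} {mkState (x ∷ i) s1 s2 o} r1 (rule2-guarded I g) r3)
  ... | refl with rule3-fits {x} {i} {s1} {s2} {o} r3
  ... | below , above with push-guard I r1 g below | trans (rule1-read n x i s1 s2 o) r1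
  ... | inj₁ (refl , refl) | r1′ = run-block-start (push-invariant I below above) r1′ rest
  ... | inj₂ g′ | r1′ with run-main (push-invariant I below above) r1′ g′ rest
  ...   | ts , refl , legal = push ∷ ts , refl , pushed legal

  -- The next value c+1 was read onto the empty first stack: rule (2)
  -- transfers it, and the block's outputs follow.
  run-block-start : ∀ {n c r i s2 o w} → Invariant n c r (mkState i (suc c ∷ []) s2 o) →
    rule1 n (mkState i (suc c ∷ []) s2 o) ≡ false → ADIRun n (mkState i (suc c ∷ []) s2 o) w →
    Tokenised (mkState (suc c ∷ i) [] s2 o) (E ∷ w)
  run-block-start I r1 (done _ () _)
  run-block-start {r = zero} {i} I r1 (stage eq rest) =
    ⊥-elim (nothing-left I (∈-++⁺ʳ i (here refl)))
  run-block-start {n} {c} {suc r} {i} {s2} {o} I r1 (stage eq rest)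
    with trans (sym eq) (stage-transfer {n} {mkState i (suc c ∷ []) s2 o} r1 (rule2-single I))
  ... | refl with run-block (move-invariant I) (rule1-next (move-invariant I)) rest
  ... | t , ts , b′ , refl , len , legal = block t ∷ ts , refl , block-run (suc-injective len) legal

  run-block : ∀ {n c r i s2 o w} → Invariant n c r (mkState i [] s2 o) →
    rule1 n (mkState i [] s2 o) ≡ true → ADIRun n (mkState i [] s2 o) w →
    BlockTail (mkState i [] s2 o) w
  run-block I r1 run with rule1-fires I r1
  run-block I r1 (done _ _ ()) | _ , _ , refl , refl
  run-block {n} {c} {i = i} {o = o} I r1 (stage eq rest) | s2 , _ , refl , refl
    with trans (sym eq) (stage-output {n} {mkState i [] (suc c ∷ s2) o} r1)
  ... | refl with true-or-false (rule1 n (mkState i [] s2 (o ++ [ suc c ])))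
  ... | inj₁ r1′ with run-block (pop-invariant I) r1′ rest
  ...   | t , ts , b′ , refl , len , legal = suc t , ts , b′ , refl , cong suc len , legal
  run-block I r1 (stage eq rest) | _ , _ , refl , refl | refl | inj₂ r1′
    with run-main (pop-invariant I) r1′ (inj₁ refl) rest
  ... | ts , refl , legal = 0 , ts , _ , refl , refl , legal

-- Lemma 3.5: the ADI word of a permutation of [n] splits into legal
-- tokens, and Φ of a legal token word is a Schröder path.
lemma3p5 : (n : ℕ) (π : List ℕ) (W : List Op) →
    0 < n → π ↭ [1‥ n ] → DISortable n π → ADIWord n π W →
    SchroderPath (n ∸ 1) (Φ W)
lemma3p5 n π W 0<n π↭ _ adi with run-main (initial-invariant π↭) refl (inj₁ refl) adi
... | ts , refl , legal = tokens-schroder 0<n (subst (λ k → Legal k 0 0 ts) length-π legal)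
  where
  length-π : length π ≡ n
  length-π = trans (↭-length π↭) (length-applyUpTo suc n)
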